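{- Let $n\in\mathbb N$ and $k\in\mathbb N_0$. (1) If $k$ is even, then $$\sum_{i=0}^{n+1}\frac{(-1)^i}{2^i}\binom{n+1}i \binom{n+i+1}k\left((-1)^iE_{n+i-k+1}(0)+(-1)^{n}\right)=0.$$ (2) If $k$ is odd, then $$\sum_{i=0}^{n+1}\frac{(-1)^i}{2^{i}}\binom{n+1}i\binom{n+i+1}k=0.$$
   Context: The Euler polynomials $E_n(a)$ are defined by $\frac{2e^{at}}{e^t+1}=\sum_{n=0}^\infty E_n(a)\frac{t^n}{n!}$. $\binom{N}{k}$ is the binomial coefficient, equal to $0$ when $k>N$; any term whose binomial coefficient vanishes (in particular any term in which an Euler polynomial would have negative index) is interpreted as $0$. -}

module Defs where

open import Data.Nat as ℕ using (ℕ; zero; suc)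
open import Data.Nat.Combinatorics using (_C_)
open import Data.Integer using (+_)
open import Data.Rational using (ℚ; _+_; _*_; _-_; -_; _/_; 0ℚ; 1ℚ; ½)
open import Data.List using (List; []; _∷_; _++_; [_]; foldr; zipWith; upTo; applyUpTo; reverse)

ℕ→ℚ : ℕ → ℚ
ℕ→ℚ n = + n / 1

_^ℚ_ : ℚ → ℕ → ℚ
x ^ℚ zero  = 1ℚ
x ^ℚ suc n = x * (x ^ℚ n)

Σ< : ℕ → (ℕ → ℚ) → ℚ
Σ< n f = foldr _+_ 0ℚ (applyUpTo f n)

sumℚ : List ℚ → ℚ
sumℚ = foldr _+_ 0ℚ

-- Euler polynomials, from comparing coefficients of t^n in
--   (e^t + 1) Σ E_m(a) t^m/m! = 2 e^{a t}:
--   Σ_{k=0}^{n} C(n,k) E_k(a) + E_n(a) = 2 a^n, i.e.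
--   E_n(a) = a^n - ½ Σ_{k<n} C(n,k) E_k(a).
EulerNext : ℕ → ℚ → List ℚ → ℚ
EulerNext n a prev = (a ^ℚ n) - ½ * sumℚ (zipWith (λ k e → ℕ→ℚ (n C k) * e) (upTo n) prev)

EulerList : ℕ → ℚ → List ℚ
EulerList zero    a = []
EulerList (suc n) a = EulerList n a ++ [ EulerNext n a (EulerList n a) ]

headOr0 : List ℚ → ℚ
headOr0 []      = 0ℚ
headOr0 (x ∷ _) = x

E : ℕ → ℚ → ℚ
E n a = headOr0 (reverse (EulerList (suc n) a))

module Submission where

-- Write e m = E_m(0), φ j = Σ_{t ≤ j} C(j,t) e t and S_N(m) = Σ_{i ≤ N} (-½)^i C(N,i) C(N+i,m);
-- the sum in (2) is S_{n+1}(k).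
--
-- Pascal's rule in both binomial coefficients gives S_{N+1}(m+2) = ½ (S_N(m+2) - S_N(m)) and
-- S_{N+1}(1) = ½ S_N(1), so S_N vanishes at odd arguments by induction on N: this is (2).
--
-- The defining recurrence of the Euler polynomials says φ j = 2·0^j - e j.  Binomial inversion
-- e l = (-1)^l Σ_j C(l,j) (-1)^j φ j then shows that e l + (-1)^l e l satisfies the same recurrence
-- as 2·0^l, whose solution is unique; hence e vanishes at even arguments ≥ 2, and so does φ.
--
-- For (1), expand each e(N+i-k) by binomial inversion and use C(M,k) C(M-k,j) = C(k+j,k) C(M,k+j).
-- Exchanging the sums turns the first half of the sum into
-- (-1)^N (-1)^k Σ_j C(k+j,k) (-1)^j φ j S_N(k+j) with N = n+1.  For k even and j ≥ 1 either
-- k+j is odd, so S_N(k+j) = 0 by (2), or j is even, so φ j = 0.  Only j = 0 survives, leaving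
-- (-1)^(n+1) S_N(k), which cancels the second half (-1)^n S_N(k).

module FiniteSums where
  open import Defs using (Σ<)
  open import Data.Nat as ℕ using (ℕ; zero; suc; _<_; _≤_; z≤n; s≤s)
  open import Data.Nat.Properties using (m+[n∸m]≡n)
  open import Data.Rational using (ℚ; _+_; _*_; 0ℚ)
  open import Data.Rational.Properties using (*-zeroʳ; *-distribˡ-+; +-identityˡ; +-identityʳ; +-assoc)
  open import Data.Rational.Solver using (module +-*-Solver)
  open import Relation.Binary.PropositionalEquality using (_≡_; refl; cong; cong₂; trans; sym)
  open +-*-Solver

  Σ<-cong : ∀ n {f g : ℕ → ℚ} → (∀ i → i < n → f i ≡ g i) → Σ< n f ≡ Σ< n g
  Σ<-cong zero    f≡g = refl
  Σ<-cong (suc n) f≡g = cong₂ _+_ (f≡g 0 (s≤s z≤n)) (Σ<-cong n (λ i i<n → f≡g (suc i) (s≤s i<n)))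

  Σ<-zero : ∀ n (f : ℕ → ℚ) → (∀ i → i < n → f i ≡ 0ℚ) → Σ< n f ≡ 0ℚ
  Σ<-zero zero    f f≡0 = refl
  Σ<-zero (suc n) f f≡0 = cong₂ _+_ (f≡0 0 (s≤s z≤n)) (Σ<-zero n (λ i → f (suc i)) (λ i i<n → f≡0 (suc i) (s≤s i<n)))

  Σ<-distrib-+ : ∀ n (f g : ℕ → ℚ) → Σ< n (λ i → f i + g i) ≡ Σ< n f + Σ< n g
  Σ<-distrib-+ zero    f g = refl
  Σ<-distrib-+ (suc n) f g = trans (cong (f 0 + g 0 +_) (Σ<-distrib-+ n (λ i → f (suc i)) (λ i → g (suc i))))
    (solve 4 (λ a b F G → (a :+ b) :+ (F :+ G) := (a :+ F) :+ (b :+ G)) refl (f 0) (g 0) _ _)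

  *-distribˡ-Σ< : ∀ n c (f : ℕ → ℚ) → c * Σ< n f ≡ Σ< n (λ i → c * f i)
  *-distribˡ-Σ< zero    c f = *-zeroʳ c
  *-distribˡ-Σ< (suc n) c f = trans (*-distribˡ-+ c (f 0) _) (cong (c * f 0 +_) (*-distribˡ-Σ< n c (λ i → f (suc i))))

  Σ<-init-last : ∀ n (f : ℕ → ℚ) → Σ< (suc n) f ≡ Σ< n f + f n
  Σ<-init-last zero    f = trans (+-identityʳ (f 0)) (sym (+-identityˡ (f 0)))
  Σ<-init-last (suc n) f = trans (cong (f 0 +_) (Σ<-init-last n (λ i → f (suc i)))) (sym (+-assoc (f 0) _ _))

  Σ<-+-zeros : ∀ m d (f : ℕ → ℚ) → (∀ i → m ≤ i → f i ≡ 0ℚ) → Σ< (m ℕ.+ d) f ≡ Σ< m f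
  Σ<-+-zeros zero    d f f≡0 = Σ<-zero d f (λ i _ → f≡0 i z≤n)
  Σ<-+-zeros (suc m) d f f≡0 = cong (f 0 +_) (Σ<-+-zeros m d (λ i → f (suc i)) (λ i m≤i → f≡0 (suc i) (s≤s m≤i)))

  Σ<-extend : ∀ m n (f : ℕ → ℚ) → m ≤ n → (∀ i → m ≤ i → f i ≡ 0ℚ) → Σ< m f ≡ Σ< n f
  Σ<-extend m n f m≤n f≡0 = trans (sym (Σ<-+-zeros m (n ℕ.∸ m) f f≡0)) (cong (λ x → Σ< x f) (m+[n∸m]≡n m≤n))

  Σ<-comm : ∀ m n (f : ℕ → ℕ → ℚ) → Σ< m (λ i → Σ< n (f i)) ≡ Σ< n (λ j → Σ< m (λ i → f i j))
  Σ<-comm zero    n f = sym (Σ<-zero n (λ _ → 0ℚ) (λ _ _ → refl))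
  Σ<-comm (suc m) n f = trans (cong (Σ< n (f 0) +_) (Σ<-comm m n (λ i → f (suc i))))
    (sym (Σ<-distrib-+ n (f 0) (λ j → Σ< m (λ i → f (suc i) j))))

module SubsetOfSubset where
  open import Data.Nat using (_+_; _*_; _∸_; _<_; _≤_; _!)
  open import Data.Nat.Properties using (+-assoc; m+n∸m≡n; m≤n⇒∃[o]m+o≡n; *-cancelʳ-≡; *-zeroʳ; m*n≢0; _!≢0; _!*_!≢0; m≤m+n; ≤-<-connex; +-monoʳ-<)
  open import Data.Nat.Combinatorics using (_C_; nCk≡n!/k![n-k]!; k![n∸k]!∣n!; k>n⇒nCk≡0)
  open import Data.Sum using ([_,_]′)
  open import Data.Nat.DivMod using (m/n*n≡m)
  open import Data.Nat.Solver using (module +-*-Solver)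
  open import Data.Product using (_,_)
  open import Relation.Binary.PropositionalEquality using (_≡_; refl; cong; trans; sym; module ≡-Reasoning)
  open +-*-Solver

  [m+n]Cm*[m!*n!]≡[m+n]! : ∀ m n → ((m + n) C m) * (m ! * n !) ≡ (m + n) !
  [m+n]Cm*[m!*n!]≡[m+n]! m n = begin
    ((m + n) C m) * (m ! * n !)                ≡⟨ cong (λ x → ((m + n) C m) * (m ! * x !)) (sym (m+n∸m≡n m n)) ⟩
    ((m + n) C m) * (m ! * (m + n ∸ m) !)      ≡⟨ nCk*[k!*[n∸k]!]≡n! (m≤m+n m n) ⟩
    (m + n) !                                  ∎
    where
    open ≡-Reasoning
    nCk*[k!*[n∸k]!]≡n! : ∀ {n k} → k ≤ n → (n C k) * (k ! * (n ∸ k) !) ≡ n !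
    nCk*[k!*[n∸k]!]≡n! {n} {k} k≤n = trans (cong (_* (k ! * (n ∸ k) !)) (nCk≡n!/k![n-k]! k≤n))
      (m/n*n≡m {{k !* (n ∸ k) !≢0}} (k![n∸k]!∣n! k≤n))

  [k+[j+e]]Ck*[j+e]Cj≡[k+j]Ck*[k+[j+e]]C[k+j] : ∀ k j e →
    ((k + (j + e)) C k) * ((j + e) C j) ≡ ((k + j) C k) * ((k + (j + e)) C (k + j))
  [k+[j+e]]Ck*[j+e]Cj≡[k+j]Ck*[k+[j+e]]C[k+j] k j e =
    *-cancelʳ-≡ _ _ (k ! * (j ! * e !)) {{m*n≢0 (k !) (j ! * e !) {{k !≢0}} {{j !* e !≢0}}}} (begin
      ((k + (j + e)) C k) * ((j + e) C j) * (k ! * (j ! * e !))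
        ≡⟨ solve 5 (λ a b x y z → a :* b :* (x :* (y :* z)) := a :* (x :* (b :* (y :* z)))) refl ((k + (j + e)) C k) ((j + e) C j) (k !) (j !) (e !) ⟩
      ((k + (j + e)) C k) * (k ! * (((j + e) C j) * (j ! * e !)))
        ≡⟨ cong (λ x → ((k + (j + e)) C k) * (k ! * x)) ([m+n]Cm*[m!*n!]≡[m+n]! j e) ⟩
      ((k + (j + e)) C k) * (k ! * (j + e) !)
        ≡⟨ [m+n]Cm*[m!*n!]≡[m+n]! k (j + e) ⟩
      (k + (j + e)) !
        ≡⟨ cong _! (sym (+-assoc k j e)) ⟩
      (k + j + e) !
        ≡⟨ sym ([m+n]Cm*[m!*n!]≡[m+n]! (k + j) e) ⟩
      ((k + j + e) C (k + j)) * ((k + j) ! * e !)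
        ≡⟨ cong (λ x → ((k + j + e) C (k + j)) * (x * e !)) (sym ([m+n]Cm*[m!*n!]≡[m+n]! k j)) ⟩
      ((k + j + e) C (k + j)) * (((k + j) C k) * (k ! * j !) * e !)
        ≡⟨ cong (λ x → (x C (k + j)) * (((k + j) C k) * (k ! * j !) * e !)) (+-assoc k j e) ⟩
      ((k + (j + e)) C (k + j)) * (((k + j) C k) * (k ! * j !) * e !)
        ≡⟨ solve 5 (λ a b x y z → a :* (b :* (x :* y) :* z) := b :* a :* (x :* (y :* z))) refl ((k + (j + e)) C (k + j)) ((k + j) C k) (k !) (j !) (e !) ⟩
      ((k + j) C k) * ((k + (j + e)) C (k + j)) * (k ! * (j ! * e !)) ∎)
    where open ≡-Reasoning

  [k+d]Ck*dCj≡[k+j]Ck*[k+d]C[k+j] : ∀ k d j → ((k + d) C k) * (d C j) ≡ ((k + j) C k) * ((k + d) C (k + j))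
  [k+d]Ck*dCj≡[k+j]Ck*[k+d]C[k+j] k d j = [ in-range , out-of-range ]′ (≤-<-connex j d)
    where
    in-range : j ≤ d → ((k + d) C k) * (d C j) ≡ ((k + j) C k) * ((k + d) C (k + j))
    in-range j≤d with m≤n⇒∃[o]m+o≡n j≤d
    ... | e , refl = [k+[j+e]]Ck*[j+e]Cj≡[k+j]Ck*[k+[j+e]]C[k+j] k j e
    out-of-range : d < j → ((k + d) C k) * (d C j) ≡ ((k + j) C k) * ((k + d) C (k + j))
    out-of-range d<j = begin
      ((k + d) C k) * (d C j)               ≡⟨ cong (((k + d) C k) *_) (k>n⇒nCk≡0 d<j) ⟩
      ((k + d) C k) * 0                     ≡⟨ *-zeroʳ ((k + d) C k) ⟩
      0                                     ≡⟨ sym (*-zeroʳ ((k + j) C k)) ⟩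
      ((k + j) C k) * 0                     ≡⟨ cong (((k + j) C k) *_) (sym (k>n⇒nCk≡0 (+-monoʳ-< k d<j))) ⟩
      ((k + j) C k) * ((k + d) C (k + j))   ∎
      where open ≡-Reasoning

module NatToRational where
  open import Defs using (ℕ→ℚ)
  open import Data.Nat as ℕ using (ℕ; suc; _<_)
  open import Data.Nat.Combinatorics using (_C_; nCn≡1; k>n⇒nCk≡0; nCk+nC[k+1]≡[n+1]C[k+1])
  open SubsetOfSubset
  open import Data.Integer as ℤ using (+_)
  open import Data.Integer.Properties as ℤ using (pos-+; pos-*)
  open import Data.Rational using (_+_; _*_; 0ℚ; 1ℚ; toℚᵘ)
  open import Data.Rational.Properties using (toℚᵘ-injective; toℚᵘ-fromℚᵘ; toℚᵘ-homo-+; toℚᵘ-homo-*)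
  import Data.Rational.Unnormalised as ℚᵘ
  open import Data.Rational.Unnormalised.Properties using (≃-trans; ≃-sym; +-cong; *-cong)
  open import Relation.Binary.PropositionalEquality using (_≡_; cong; cong₂; trans; sym; module ≡-Reasoning)

  -- ℕ→ℚ n is definitionally fromℚᵘ (mkℚᵘ (+ n) 0).
  toℚᵘ-ℕ→ℚ : ∀ n → toℚᵘ (ℕ→ℚ n) ℚᵘ.≃ ℚᵘ.mkℚᵘ (+ n) 0
  toℚᵘ-ℕ→ℚ n = toℚᵘ-fromℚᵘ (ℚᵘ.mkℚᵘ (+ n) 0)

  ℕ→ℚ-homo-+ : ∀ a b → ℕ→ℚ (a ℕ.+ b) ≡ ℕ→ℚ a + ℕ→ℚ b
  ℕ→ℚ-homo-+ a b = toℚᵘ-injective (≃-trans (toℚᵘ-ℕ→ℚ (a ℕ.+ b)) (≃-trans homo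
    (≃-sym (≃-trans (toℚᵘ-homo-+ (ℕ→ℚ a) (ℕ→ℚ b)) (+-cong (toℚᵘ-ℕ→ℚ a) (toℚᵘ-ℕ→ℚ b))))))
    where
    homo : ℚᵘ.mkℚᵘ (+ (a ℕ.+ b)) 0 ℚᵘ.≃ ℚᵘ.mkℚᵘ (+ a) 0 ℚᵘ.+ ℚᵘ.mkℚᵘ (+ b) 0
    homo = ℚᵘ.*≡* (trans (ℤ.*-identityʳ _) (trans (pos-+ a b)
      (sym (trans (ℤ.*-identityʳ _) (cong₂ ℤ._+_ (ℤ.*-identityʳ (+ a)) (ℤ.*-identityʳ (+ b)))))))

  ℕ→ℚ-homo-* : ∀ a b → ℕ→ℚ (a ℕ.* b) ≡ ℕ→ℚ a * ℕ→ℚ b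
  ℕ→ℚ-homo-* a b = toℚᵘ-injective (≃-trans (toℚᵘ-ℕ→ℚ (a ℕ.* b)) (≃-trans homo
    (≃-sym (≃-trans (toℚᵘ-homo-* (ℕ→ℚ a) (ℕ→ℚ b)) (*-cong (toℚᵘ-ℕ→ℚ a) (toℚᵘ-ℕ→ℚ b))))))
    where
    homo : ℚᵘ.mkℚᵘ (+ (a ℕ.* b)) 0 ℚᵘ.≃ ℚᵘ.mkℚᵘ (+ a) 0 ℚᵘ.* ℚᵘ.mkℚᵘ (+ b) 0
    homo = ℚᵘ.*≡* (trans (ℤ.*-identityʳ _) (trans (pos-* a b) (sym (ℤ.*-identityʳ _))))

  ℕ→ℚ-pascal : ∀ n k → ℕ→ℚ (suc n C suc k) ≡ ℕ→ℚ (n C k) + ℕ→ℚ (n C suc k)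
  ℕ→ℚ-pascal n k = trans (cong ℕ→ℚ (sym (nCk+nC[k+1]≡[n+1]C[k+1] n k))) (ℕ→ℚ-homo-+ (n C k) (n C suc k))

  ℕ→ℚ-nCk≡0 : ∀ {n k} → n < k → ℕ→ℚ (n C k) ≡ 0ℚ
  ℕ→ℚ-nCk≡0 n<k = cong ℕ→ℚ (k>n⇒nCk≡0 n<k)

  ℕ→ℚ-nCn≡1 : ∀ n → ℕ→ℚ (n C n) ≡ 1ℚ
  ℕ→ℚ-nCn≡1 n = cong ℕ→ℚ (nCn≡1 n)

  ℕ→ℚ-[k+d]Ck*dCj : ∀ k d j → ℕ→ℚ ((k ℕ.+ d) C k) * ℕ→ℚ (d C j) ≡ ℕ→ℚ ((k ℕ.+ j) C k) * ℕ→ℚ ((k ℕ.+ d) C (k ℕ.+ j))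
  ℕ→ℚ-[k+d]Ck*dCj k d j = begin
    ℕ→ℚ ((k ℕ.+ d) C k) * ℕ→ℚ (d C j)                  ≡⟨ sym (ℕ→ℚ-homo-* ((k ℕ.+ d) C k) (d C j)) ⟩
    ℕ→ℚ (((k ℕ.+ d) C k) ℕ.* (d C j))                  ≡⟨ cong ℕ→ℚ ([k+d]Ck*dCj≡[k+j]Ck*[k+d]C[k+j] k d j) ⟩
    ℕ→ℚ (((k ℕ.+ j) C k) ℕ.* ((k ℕ.+ d) C (k ℕ.+ j)))  ≡⟨ ℕ→ℚ-homo-* ((k ℕ.+ j) C k) ((k ℕ.+ d) C (k ℕ.+ j)) ⟩
    ℕ→ℚ ((k ℕ.+ j) C k) * ℕ→ℚ ((k ℕ.+ d) C (k ℕ.+ j)) ∎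
    where open ≡-Reasoning

module Signs where
  open import Defs using (_^ℚ_)
  open import Data.Nat as ℕ using (ℕ; zero; suc)
  open import Data.Nat.Divisibility using (_∣_; divides)
  open import Data.Rational using (ℚ; _*_; -_; 1ℚ)
  open import Data.Nat.Properties using (+-comm)
  open import Data.Rational.Properties using (*-identityˡ; *-identityʳ; *-assoc)
  open import Data.Rational.Solver using (module +-*-Solver)
  open import Relation.Binary.PropositionalEquality using (_≡_; refl; cong; trans; sym; module ≡-Reasoning)
  open +-*-Solver

  sign : ℕ → ℚ
  sign j = (- 1ℚ) ^ℚ j

  sign-+ : ∀ a b → sign (a ℕ.+ b) ≡ sign a * sign b
  sign-+ zero    b = sym (*-identityˡ (sign b))
  sign-+ (suc a) b = trans (cong ((- 1ℚ) *_) (sign-+ a b)) (sym (*-assoc (- 1ℚ) (sign a) (sign b)))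

  sign-square : ∀ j → sign j * sign j ≡ 1ℚ
  sign-square zero    = refl
  sign-square (suc j) = trans (solve 1 (λ s → (con (- 1ℚ) :* s) :* (con (- 1ℚ) :* s) := s :* s) refl (sign j)) (sign-square j)

  sign-even : ∀ {j} → 2 ∣ j → sign j ≡ 1ℚ
  sign-even (divides q refl) = sign-2* q
    where
    sign-2* : ∀ q → sign (q ℕ.* 2) ≡ 1ℚ
    sign-2* zero    = refl
    sign-2* (suc q) = trans (solve 1 (λ s → con (- 1ℚ) :* (con (- 1ℚ) :* s) := s) refl (sign (q ℕ.* 2))) (sign-2* q)

  sign-+-cancelʳ : ∀ m n → sign (m ℕ.+ n) * sign n ≡ sign m
  sign-+-cancelʳ m n = begin
    sign (m ℕ.+ n) * sign n        ≡⟨ cong (_* sign n) (sign-+ m n) ⟩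
    sign m * sign n * sign n       ≡⟨ *-assoc (sign m) (sign n) (sign n) ⟩
    sign m * (sign n * sign n)     ≡⟨ cong (sign m *_) (sign-square n) ⟩
    sign m * 1ℚ                    ≡⟨ *-identityʳ (sign m) ⟩
    sign m                         ∎
    where open ≡-Reasoning

  sign-+-cancelˡ : ∀ m n → sign (m ℕ.+ n) * sign m ≡ sign n
  sign-+-cancelˡ m n = trans (cong (λ x → sign x * sign m) (+-comm m n)) (sign-+-cancelʳ n m)

module BinomialTransform where
  open import Defs using (ℕ→ℚ; _^ℚ_; Σ<)
  open FiniteSums
  open NatToRational
  open Signs
  open import Data.Nat as ℕ using (ℕ; zero; suc; _<_; _≤_; _∸_; s≤s)
  open import Data.Nat.Properties using (n≤1+n; ≤-<-connex; +-monoʳ-<; <-≤-trans; m≤m+n; m+n≤o⇒n≤o; m+[n∸m]≡n)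
  open import Data.Sum using ([_,_]′)
  open import Data.Nat.Combinatorics using (_C_)
  open import Data.Nat.Induction using (<-rec)
  open import Data.Rational using (ℚ; _+_; _*_; _-_; -_; 0ℚ; 1ℚ; ½)
  open import Data.Rational.Properties using (*-zeroˡ; *-zeroʳ; *-identityˡ; *-assoc; *-distribˡ-+; *-distribʳ-+)
  open import Data.Rational.Solver using (module +-*-Solver)
  open import Function using (_∘_)
  open import Relation.Binary.PropositionalEquality using (_≡_; refl; cong; trans; sym; subst; module ≡-Reasoning)
  open +-*-Solver

  alternate : (ℕ → ℚ) → ℕ → ℚ
  alternate a j = sign j * a j

  binomial : (ℕ → ℚ) → ℕ → ℚ
  binomial a l = Σ< (suc l) (λ j → ℕ→ℚ (l C j) * a j)

  binomial-distrib-+ : ∀ (a b : ℕ → ℚ) l → binomial (λ j → a j + b j) l ≡ binomial a l + binomial b l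
  binomial-distrib-+ a b l = trans (Σ<-cong (suc l) (λ j _ → *-distribˡ-+ (ℕ→ℚ (l C j)) (a j) (b j)))
    (Σ<-distrib-+ (suc l) (λ j → ℕ→ℚ (l C j) * a j) (λ j → ℕ→ℚ (l C j) * b j))

  binomial-*ˡ : ∀ c (a : ℕ → ℚ) l → binomial (λ j → c * a j) l ≡ c * binomial a l
  binomial-*ˡ c a l = trans (Σ<-cong (suc l) (λ j _ → solve 3 (λ x c a → x :* (c :* a) := c :* (x :* a)) refl (ℕ→ℚ (l C j)) c (a j)))
    (sym (*-distribˡ-Σ< (suc l) c (λ j → ℕ→ℚ (l C j) * a j)))

  binomial-suc : ∀ (a : ℕ → ℚ) l → binomial a (suc l) ≡ binomial a l + binomial (a ∘ suc) l
  binomial-suc a l = begin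
    a₀ + Σ< (suc l) (λ j → ℕ→ℚ (suc l C suc j) * a (suc j))
      ≡⟨ cong (a₀ +_) (Σ<-cong (suc l) (λ j _ → trans (cong (_* a (suc j)) (ℕ→ℚ-pascal l j)) (*-distribʳ-+ (a (suc j)) (ℕ→ℚ (l C j)) (ℕ→ℚ (l C suc j))))) ⟩
    a₀ + Σ< (suc l) (λ j → ℕ→ℚ (l C j) * a (suc j) + ℕ→ℚ (l C suc j) * a (suc j))
      ≡⟨ cong (a₀ +_) (Σ<-distrib-+ (suc l) (λ j → ℕ→ℚ (l C j) * a (suc j)) shifted) ⟩
    a₀ + (binomial (a ∘ suc) l + Σ< (suc l) shifted)
      ≡⟨ cong (λ s → a₀ + (binomial (a ∘ suc) l + s)) (sym (Σ<-extend l (suc l) shifted (n≤1+n l)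
           (λ j l≤j → trans (cong (_* a (suc j)) (ℕ→ℚ-nCk≡0 (s≤s l≤j))) (*-zeroˡ (a (suc j)))))) ⟩
    a₀ + (binomial (a ∘ suc) l + Σ< l shifted)
      ≡⟨ solve 3 (λ x y z → x :+ (y :+ z) := (x :+ z) :+ y) refl a₀ (binomial (a ∘ suc) l) (Σ< l shifted) ⟩
    binomial a l + binomial (a ∘ suc) l ∎
    where
    open ≡-Reasoning
    a₀ : ℚ
    a₀ = ℕ→ℚ 1 * a 0
    shifted : ℕ → ℚ
    shifted j = ℕ→ℚ (l C suc j) * a (suc j)

  binomial-cong : ∀ {a b : ℕ → ℚ} l → (∀ j → a j ≡ b j) → binomial a l ≡ binomial b l
  binomial-cong l a≡b = Σ<-cong (suc l) (λ j _ → cong (ℕ→ℚ (l C j) *_) (a≡b j))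

  binomial-inversion : ∀ (a : ℕ → ℚ) l → sign l * binomial (alternate (binomial a)) l ≡ a l
  binomial-inversion a zero = solve 1 (λ x → con 1ℚ :* (con 1ℚ :* (con 1ℚ :* (con 1ℚ :* x :+ con 0ℚ)) :+ con 0ℚ) := x) refl (a 0)
  binomial-inversion a (suc l) = begin
    sign (suc l) * binomial g (suc l)
      ≡⟨ cong (sign (suc l) *_) (binomial-suc g l) ⟩
    sign (suc l) * (binomial g l + binomial (g ∘ suc) l)
      ≡⟨ cong (λ x → sign (suc l) * (binomial g l + x)) (trans (binomial-cong l g-suc) (binomial-*ˡ (- 1ℚ) (λ j → g j + g′ j) l)) ⟩
    sign (suc l) * (binomial g l + - 1ℚ * binomial (λ j → g j + g′ j) l)
      ≡⟨ cong (λ x → sign (suc l) * (binomial g l + - 1ℚ * x)) (binomial-distrib-+ g g′ l) ⟩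
    sign (suc l) * (binomial g l + - 1ℚ * (binomial g l + binomial g′ l))
      ≡⟨ solve 3 (λ s x y → (con (- 1ℚ) :* s) :* (x :+ con (- 1ℚ) :* (x :+ y)) := s :* y) refl (sign l) (binomial g l) (binomial g′ l) ⟩
    sign l * binomial g′ l
      ≡⟨ binomial-inversion (a ∘ suc) l ⟩
    a (suc l) ∎
    where
    open ≡-Reasoning
    g g′ : ℕ → ℚ
    g = alternate (binomial a)
    g′ = alternate (binomial (a ∘ suc))
    g-suc : ∀ j → g (suc j) ≡ - 1ℚ * (g j + g′ j)
    g-suc j = trans (cong (sign (suc j) *_) (binomial-suc a j))
      (solve 3 (λ s x y → (con (- 1ℚ) :* s) :* (x :+ y) := con (- 1ℚ) :* (s :* x :+ s :* y)) refl (sign j) (binomial a j) (binomial (a ∘ suc) j))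

  binomial-δ : ∀ (x : ℕ → ℚ) l → binomial (λ j → x j * 0ℚ ^ℚ j) l ≡ x 0
  binomial-δ x l = trans (cong (ℕ→ℚ 1 * (x 0 * 1ℚ) +_)
      (Σ<-zero l _ (λ j _ → solve 3 (λ c y z → c :* (y :* (con 0ℚ :* z)) := con 0ℚ) refl (ℕ→ℚ (l C suc j)) (x (suc j)) (0ℚ ^ℚ j))))
    (solve 1 (λ y → con 1ℚ :* (y :* con 1ℚ) :+ con 0ℚ := y) refl (x 0))

  binomial-init-last : ∀ (a : ℕ → ℚ) l → binomial a l ≡ Σ< l (λ j → ℕ→ℚ (l C j) * a j) + a l
  binomial-init-last a l = trans (Σ<-init-last l (λ j → ℕ→ℚ (l C j) * a j))
    (cong (Σ< l (λ j → ℕ→ℚ (l C j) * a j) +_) (trans (cong (_* a l) (ℕ→ℚ-nCn≡1 l)) (*-identityˡ (a l))))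

  binomial-+-injective : ∀ (a b : ℕ → ℚ) → (∀ l → binomial a l + a l ≡ binomial b l + b l) → ∀ l → a l ≡ b l
  binomial-+-injective a b eq = <-rec (λ l → a l ≡ b l) step
    where
    cancel : ∀ p {x y} → p + x + x ≡ p + y + y → x ≡ y
    cancel p {x} {y} eq = begin
      x                         ≡⟨ solve 2 (λ p x → x := con ½ :* ((p :+ x :+ x) :- p)) refl p x ⟩
      ½ * ((p + x + x) - p)     ≡⟨ cong (λ z → ½ * (z - p)) eq ⟩
      ½ * ((p + y + y) - p)     ≡⟨ solve 2 (λ p y → con ½ :* ((p :+ y :+ y) :- p) := y) refl p y ⟩
      y                         ∎
      where open ≡-Reasoning
    step : ∀ l → (∀ {j} → j < l → a j ≡ b j) → a l ≡ b l
    step l IH = cancel (Σ< l (λ j → ℕ→ℚ (l C j) * a j)) (begin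
      Σ< l (λ j → ℕ→ℚ (l C j) * a j) + a l + a l  ≡⟨ cong (_+ a l) (sym (binomial-init-last a l)) ⟩
      binomial a l + a l                           ≡⟨ eq l ⟩
      binomial b l + b l                           ≡⟨ cong (_+ b l) (binomial-init-last b l) ⟩
      Σ< l (λ j → ℕ→ℚ (l C j) * b j) + b l + b l  ≡⟨ cong (λ p → p + b l + b l) (Σ<-cong l (λ j j<l → cong (ℕ→ℚ (l C j) *_) (sym (IH j<l)))) ⟩
      Σ< l (λ j → ℕ→ℚ (l C j) * a j) + b l + b l  ∎)
      where open ≡-Reasoning

  binomialInversionTerm : (ℕ → ℚ) → ℕ → ℕ → ℕ → ℚ
  binomialInversionTerm a M k j = ℕ→ℚ ((k ℕ.+ j) C k) * ℕ→ℚ (M C (k ℕ.+ j)) * alternate (binomial a) j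

  binomialInversionTerm-vanishes : ∀ (a : ℕ → ℚ) M k j → M < k ℕ.+ j → binomialInversionTerm a M k j ≡ 0ℚ
  binomialInversionTerm-vanishes a M k j M<k+j =
    trans (cong (λ c → ℕ→ℚ ((k ℕ.+ j) C k) * c * alternate (binomial a) j) (ℕ→ℚ-nCk≡0 M<k+j))
      (solve 2 (λ x y → x :* con 0ℚ :* y := con 0ℚ) refl (ℕ→ℚ ((k ℕ.+ j) C k)) (alternate (binomial a) j))

  binomial-inversion-at-sum : ∀ (a : ℕ → ℚ) k d X → k ℕ.+ d ≤ X →
    ℕ→ℚ ((k ℕ.+ d) C k) * a d ≡ sign (k ℕ.+ d) * sign k * Σ< (suc X) (binomialInversionTerm a (k ℕ.+ d) k)
  binomial-inversion-at-sum a k d X k+d≤X = begin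
    ℕ→ℚ ((k ℕ.+ d) C k) * a d
      ≡⟨ cong (ℕ→ℚ ((k ℕ.+ d) C k) *_) (sym (binomial-inversion a d)) ⟩
    ℕ→ℚ ((k ℕ.+ d) C k) * (sign d * binomial (alternate (binomial a)) d)
      ≡⟨ solve 3 (λ c s b → c :* (s :* b) := s :* (c :* b)) refl (ℕ→ℚ ((k ℕ.+ d) C k)) (sign d) (binomial (alternate (binomial a)) d) ⟩
    sign d * (ℕ→ℚ ((k ℕ.+ d) C k) * binomial (alternate (binomial a)) d)
      ≡⟨ cong (sign d *_) (trans (*-distribˡ-Σ< (suc d) (ℕ→ℚ ((k ℕ.+ d) C k)) (λ j → ℕ→ℚ (d C j) * alternate (binomial a) j))
                                 (Σ<-cong (suc d) (λ j _ → reassociate j))) ⟩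
    sign d * Σ< (suc d) (binomialInversionTerm a (k ℕ.+ d) k)
      ≡⟨ cong (sign d *_) (Σ<-extend (suc d) (suc X) (binomialInversionTerm a (k ℕ.+ d) k) (s≤s (m+n≤o⇒n≤o k k+d≤X))
                                    (λ j d<j → binomialInversionTerm-vanishes a (k ℕ.+ d) k j (+-monoʳ-< k d<j))) ⟩
    sign d * Σ< (suc X) (binomialInversionTerm a (k ℕ.+ d) k)
      ≡⟨ cong (_* Σ< (suc X) (binomialInversionTerm a (k ℕ.+ d) k)) (sym (sign-+-cancelˡ k d)) ⟩
    sign (k ℕ.+ d) * sign k * Σ< (suc X) (binomialInversionTerm a (k ℕ.+ d) k) ∎
    where
    open ≡-Reasoning
    reassociate : ∀ j → ℕ→ℚ ((k ℕ.+ d) C k) * (ℕ→ℚ (d C j) * alternate (binomial a) j) ≡ binomialInversionTerm a (k ℕ.+ d) k j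
    reassociate j = trans (sym (*-assoc (ℕ→ℚ ((k ℕ.+ d) C k)) (ℕ→ℚ (d C j)) (alternate (binomial a) j)))
      (cong (_* alternate (binomial a) j) (ℕ→ℚ-[k+d]Ck*dCj k d j))

  binomial-inversion-shifted : ∀ (a : ℕ → ℚ) M k X → M ≤ X →
    ℕ→ℚ (M C k) * a (M ∸ k) ≡ sign M * sign k * Σ< (suc X) (binomialInversionTerm a M k)
  binomial-inversion-shifted a M k X M≤X = [ in-range , out-of-range ]′ (≤-<-connex k M)
    where
    in-range : k ≤ M → ℕ→ℚ (M C k) * a (M ∸ k) ≡ sign M * sign k * Σ< (suc X) (binomialInversionTerm a M k)
    in-range k≤M = subst (λ m → ℕ→ℚ (m C k) * a (M ∸ k) ≡ sign m * sign k * Σ< (suc X) (binomialInversionTerm a m k))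
      (m+[n∸m]≡n k≤M) (binomial-inversion-at-sum a k (M ∸ k) X (subst (_≤ X) (sym (m+[n∸m]≡n k≤M)) M≤X))
    out-of-range : M < k → ℕ→ℚ (M C k) * a (M ∸ k) ≡ sign M * sign k * Σ< (suc X) (binomialInversionTerm a M k)
    out-of-range M<k = begin
      ℕ→ℚ (M C k) * a (M ∸ k)                                    ≡⟨ cong (_* a (M ∸ k)) (ℕ→ℚ-nCk≡0 M<k) ⟩
      0ℚ * a (M ∸ k)                                             ≡⟨ *-zeroˡ (a (M ∸ k)) ⟩
      0ℚ                                                         ≡⟨ sym (*-zeroʳ (sign M * sign k)) ⟩
      sign M * sign k * 0ℚ                                       ≡⟨ cong (sign M * sign k *_) (sym (Σ<-zero (suc X) (binomialInversionTerm a M k)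
                                                                      (λ j _ → binomialInversionTerm-vanishes a M k j (<-≤-trans M<k (m≤m+n k j))))) ⟩
      sign M * sign k * Σ< (suc X) (binomialInversionTerm a M k) ∎
      where open ≡-Reasoning

module EulerPolynomials where
  open import Defs using (ℕ→ℚ; _^ℚ_; Σ<; E; EulerList; EulerNext; headOr0; sumℚ)
  open FiniteSums
  open Signs
  open BinomialTransform
  open import Data.Nat as ℕ using (ℕ; zero; suc)
  open import Data.Nat.Combinatorics using (_C_)
  open import Data.Nat.Divisibility using (_∣_)
  open import Data.List using (_∷_; [_]; _++_; zipWith; upTo; applyUpTo)
  open import Data.List.Properties using (reverse-++; applyUpTo-∷ʳ)
  open import Data.Rational using (ℚ; _+_; _*_; _-_; -_; 0ℚ; 1ℚ; ½)
  open import Data.Rational.Solver using (module +-*-Solver)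
  open import Relation.Binary.PropositionalEquality using (_≡_; refl; cong; cong₂; trans; sym; module ≡-Reasoning)
  open +-*-Solver

  E-last : ∀ m a → E m a ≡ EulerNext m a (EulerList m a)
  E-last m a = cong headOr0 (reverse-++ (EulerList m a) [ EulerNext m a (EulerList m a) ])

  EulerList-applyUpTo : ∀ m a → EulerList m a ≡ applyUpTo (λ k → E k a) m
  EulerList-applyUpTo zero    a = refl
  EulerList-applyUpTo (suc m) a = trans (cong₂ (λ xs x → xs ++ [ x ]) (EulerList-applyUpTo m a) (sym (E-last m a)))
    (applyUpTo-∷ʳ (λ k → E k a) m)

  zipWith-applyUpTo : ∀ {A B C : Set} (f : A → B → C) (g : ℕ → A) (h : ℕ → B) m →
                      zipWith f (applyUpTo g m) (applyUpTo h m) ≡ applyUpTo (λ k → f (g k) (h k)) m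
  zipWith-applyUpTo f g h zero    = refl
  zipWith-applyUpTo f g h (suc m) = cong (f (g 0) (h 0) ∷_) (zipWith-applyUpTo f (λ k → g (suc k)) (λ k → h (suc k)) m)

  E-recurrence : ∀ m a → E m a ≡ a ^ℚ m - ½ * Σ< m (λ k → ℕ→ℚ (m C k) * E k a)
  E-recurrence m a = trans (E-last m a) (cong (λ xs → a ^ℚ m - ½ * sumℚ xs)
    (trans (cong (zipWith (λ k e → ℕ→ℚ (m C k) * e) (upTo m)) (EulerList-applyUpTo m a))
           (zipWith-applyUpTo (λ k e → ℕ→ℚ (m C k) * e) (λ k → k) (λ k → E k a) m)))

  binomial-E : ∀ a m → binomial (λ k → E k a) m + E m a ≡ a ^ℚ m + a ^ℚ m
  binomial-E a m = begin
    binomial (λ k → E k a) m + E m a   ≡⟨ cong (_+ E m a) (binomial-init-last (λ k → E k a) m) ⟩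
    S + E m a + E m a                  ≡⟨ cong (λ x → S + x + x) (E-recurrence m a) ⟩
    S + (x - ½ * S) + (x - ½ * S)      ≡⟨ solve 2 (λ S x → S :+ (x :- con ½ :* S) :+ (x :- con ½ :* S) := x :+ x) refl S x ⟩
    x + x                              ∎
    where
    open ≡-Reasoning
    S x : ℚ
    S = Σ< m (λ k → ℕ→ℚ (m C k) * E k a)
    x = a ^ℚ m

  E₀ : ℕ → ℚ
  E₀ m = E m 0ℚ

  binomial-E₀ : ∀ l → binomial E₀ l ≡ 0ℚ ^ℚ l + 0ℚ ^ℚ l - E₀ l
  binomial-E₀ l = begin
    binomial E₀ l                              ≡⟨ solve 2 (λ b e → b := (b :+ e) :- e) refl (binomial E₀ l) (E₀ l) ⟩
    (binomial E₀ l + E₀ l) - E₀ l              ≡⟨ cong (_- E₀ l) (binomial-E 0ℚ l) ⟩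
    0ℚ ^ℚ l + 0ℚ ^ℚ l - E₀ l                   ∎
    where open ≡-Reasoning

  binomial-alternate-E₀ : ∀ l → binomial (alternate E₀) l + sign l * E₀ l ≡ 1ℚ + 1ℚ
  binomial-alternate-E₀ l = begin
    Ψ + sign l * E₀ l
      ≡⟨ cong (λ x → Ψ + sign l * x) (sym (binomial-inversion E₀ l)) ⟩
    Ψ + sign l * (sign l * binomial (alternate (binomial E₀)) l)
      ≡⟨ cong (λ x → Ψ + sign l * (sign l * x)) (trans (binomial-cong l split) (binomial-distrib-+ (λ j → sign j * two * 0ℚ ^ℚ j) (λ j → - 1ℚ * alternate E₀ j) l)) ⟩
    Ψ + sign l * (sign l * (binomial (λ j → sign j * two * 0ℚ ^ℚ j) l + binomial (λ j → - 1ℚ * alternate E₀ j) l))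
      ≡⟨ cong₂ (λ x y → Ψ + sign l * (sign l * (x + y))) (binomial-δ (λ j → sign j * two) l) (binomial-*ˡ (- 1ℚ) (alternate E₀) l) ⟩
    Ψ + sign l * (sign l * (two + - 1ℚ * Ψ))
      ≡⟨ solve 3 (λ p s t → p :+ s :* (s :* (t :+ con (- 1ℚ) :* p)) := p :+ (s :* s) :* (t :+ con (- 1ℚ) :* p)) refl Ψ (sign l) two ⟩
    Ψ + (sign l * sign l) * (two + - 1ℚ * Ψ)
      ≡⟨ cong (λ x → Ψ + x * (two + - 1ℚ * Ψ)) (sign-square l) ⟩
    Ψ + 1ℚ * (two + - 1ℚ * Ψ)
      ≡⟨ solve 2 (λ p t → p :+ con 1ℚ :* (t :+ con (- 1ℚ) :* p) := t) refl Ψ two ⟩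
    two ∎
    where
    open ≡-Reasoning
    Ψ two : ℚ
    Ψ = binomial (alternate E₀) l
    two = 1ℚ + 1ℚ
    split : ∀ j → alternate (binomial E₀) j ≡ sign j * two * 0ℚ ^ℚ j + - 1ℚ * alternate E₀ j
    split j = trans (cong (sign j *_) (binomial-E₀ j))
      (solve 3 (λ s z e → s :* (z :+ z :- e) := s :* (con 1ℚ :+ con 1ℚ) :* z :+ con (- 1ℚ) :* (s :* e)) refl (sign j) (0ℚ ^ℚ j) (E₀ j))

  E₀+alternate-E₀ : ∀ l → E₀ l + sign l * E₀ l ≡ (1ℚ + 1ℚ) * 0ℚ ^ℚ l
  E₀+alternate-E₀ = binomial-+-injective d c same-recurrence
    where
    d c : ℕ → ℚ
    d l = E₀ l + sign l * E₀ l
    c l = (1ℚ + 1ℚ) * 0ℚ ^ℚ l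
    same-recurrence : ∀ l → binomial d l + d l ≡ binomial c l + c l
    same-recurrence l = begin
      binomial d l + d l
        ≡⟨ cong (_+ d l) (binomial-distrib-+ E₀ (alternate E₀) l) ⟩
      (binomial E₀ l + binomial (alternate E₀) l) + (E₀ l + sign l * E₀ l)
        ≡⟨ solve 4 (λ a b c d → (a :+ b) :+ (c :+ d) := (a :+ c) :+ (b :+ d)) refl (binomial E₀ l) (binomial (alternate E₀) l) (E₀ l) (sign l * E₀ l) ⟩
      (binomial E₀ l + E₀ l) + (binomial (alternate E₀) l + sign l * E₀ l)
        ≡⟨ cong₂ _+_ (binomial-E 0ℚ l) (binomial-alternate-E₀ l) ⟩
      (0ℚ ^ℚ l + 0ℚ ^ℚ l) + (1ℚ + 1ℚ)
        ≡⟨ solve 1 (λ z → (z :+ z) :+ (con 1ℚ :+ con 1ℚ) := (con 1ℚ :+ con 1ℚ) :+ (con 1ℚ :+ con 1ℚ) :* z) refl (0ℚ ^ℚ l) ⟩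
      (1ℚ + 1ℚ) + c l
        ≡⟨ cong (_+ c l) (sym (binomial-δ (λ _ → 1ℚ + 1ℚ) l)) ⟩
      binomial c l + c l ∎
      where open ≡-Reasoning

  E₀-even : ∀ m → 2 ∣ suc m → E₀ (suc m) ≡ 0ℚ
  E₀-even m 2∣1+m = begin
    E₀ (suc m)                                 ≡⟨ solve 1 (λ e → e := con ½ :* (e :+ con 1ℚ :* e)) refl (E₀ (suc m)) ⟩
    ½ * (E₀ (suc m) + 1ℚ * E₀ (suc m))         ≡⟨ cong (λ s → ½ * (E₀ (suc m) + s * E₀ (suc m))) (sym (sign-even 2∣1+m)) ⟩
    ½ * (E₀ (suc m) + sign (suc m) * E₀ (suc m)) ≡⟨ cong (½ *_) (E₀+alternate-E₀ (suc m)) ⟩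
    ½ * ((1ℚ + 1ℚ) * (0ℚ * 0ℚ ^ℚ m))           ≡⟨ solve 1 (λ z → con ½ :* ((con 1ℚ :+ con 1ℚ) :* (con 0ℚ :* z)) := con 0ℚ) refl (0ℚ ^ℚ m) ⟩
    0ℚ                                         ∎
    where open ≡-Reasoning

  binomial-E₀-even : ∀ m → 2 ∣ suc m → binomial E₀ (suc m) ≡ 0ℚ
  binomial-E₀-even m 2∣1+m = trans (binomial-E₀ (suc m)) (trans (cong (λ e → 0ℚ ^ℚ suc m + 0ℚ ^ℚ suc m - e) (E₀-even m 2∣1+m))
    (solve 1 (λ z → con 0ℚ :* z :+ con 0ℚ :* z :- con 0ℚ := con 0ℚ) refl (0ℚ ^ℚ m)))

module AlternatingHalfSums where
  open import Defs using (ℕ→ℚ; _^ℚ_; Σ<)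
  open FiniteSums
  open NatToRational
  open import Data.Nat as ℕ using (ℕ; zero; suc; s≤s)
  open import Data.Nat.Properties using (+-suc; n≤1+n)
  open import Data.Nat.Combinatorics using (_C_)
  open import Data.Nat.Divisibility using (_∣_; divides; ∣-refl; ∣m∣n⇒∣m+n)
  open import Data.Empty using (⊥-elim)
  open import Relation.Nullary using (¬_)
  open import Function using (_∘_)
  open import Data.Rational using (ℚ; _+_; _*_; _-_; -_; 0ℚ; 1ℚ; ½)
  open import Data.Rational.Properties using (+-comm; *-distribˡ-+)
  open import Data.Rational.Solver using (module +-*-Solver)
  open import Relation.Binary.PropositionalEquality using (_≡_; refl; cong; cong₂; trans; sym; module ≡-Reasoning)
  open +-*-Solver

  halfWeight : ℕ → ℕ → ℚ
  halfWeight N i = (- ½) ^ℚ i * ℕ→ℚ (N C i)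

  alternatingHalfSum : ℕ → ℕ → ℕ → ℚ
  alternatingHalfSum N M m = Σ< (suc N) (λ i → halfWeight N i * ℕ→ℚ ((M ℕ.+ i) C m))

  private
    S : ℕ → ℕ → ℕ → ℚ
    S = alternatingHalfSum

  alternatingHalfSum-pascal : ∀ N M k → S N (suc M) (suc k) ≡ S N M (suc k) + S N M k
  alternatingHalfSum-pascal N M k = trans (Σ<-cong (suc N) (λ i _ → term i))
      (Σ<-distrib-+ (suc N) (λ i → halfWeight N i * C[M+i] (suc k) i) (λ i → halfWeight N i * C[M+i] k i))
    where
    C[M+i] : ℕ → ℕ → ℚ
    C[M+i] m i = ℕ→ℚ ((M ℕ.+ i) C m)
    term : ∀ i → halfWeight N i * ℕ→ℚ (suc (M ℕ.+ i) C suc k) ≡ halfWeight N i * C[M+i] (suc k) i + halfWeight N i * C[M+i] k i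
    term i = trans (cong (halfWeight N i *_) (trans (ℕ→ℚ-pascal (M ℕ.+ i) k) (+-comm (C[M+i] k i) (C[M+i] (suc k) i))))
      (*-distribˡ-+ (halfWeight N i) (C[M+i] (suc k) i) (C[M+i] k i))

  alternatingHalfSum-suc : ∀ N M k → S (suc N) M k ≡ S N M k + (- ½) * S N (suc M) k
  alternatingHalfSum-suc N M k = begin
    h 0 + Σ< (suc N) (λ i → halfWeight (suc N) (suc i) * ℕ→ℚ ((M ℕ.+ suc i) C k))
      ≡⟨ cong (h 0 +_) (trans (Σ<-cong (suc N) (λ i _ → term i)) (Σ<-distrib-+ (suc N) (λ i → (- ½) * h′ i) (h ∘ suc))) ⟩
    h 0 + (Σ< (suc N) (λ i → (- ½) * h′ i) + Σ< (suc N) (h ∘ suc))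
      ≡⟨ cong₂ (λ x y → h 0 + (x + y)) (sym (*-distribˡ-Σ< (suc N) (- ½) h′))
           (sym (Σ<-extend N (suc N) (h ∘ suc) (n≤1+n N) (λ i N≤i → trans (cong (λ c → (- ½) ^ℚ suc i * c * ℕ→ℚ ((M ℕ.+ suc i) C k)) (ℕ→ℚ-nCk≡0 (s≤s N≤i)))
                                                            (solve 2 (λ p c → p :* con 0ℚ :* c := con 0ℚ) refl ((- ½) ^ℚ suc i) (ℕ→ℚ ((M ℕ.+ suc i) C k)))))) ⟩
    h 0 + ((- ½) * S N (suc M) k + Σ< N (h ∘ suc))
      ≡⟨ solve 3 (λ a b c → a :+ (b :+ c) := (a :+ c) :+ b) refl (h 0) ((- ½) * S N (suc M) k) (Σ< N (h ∘ suc)) ⟩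
    S N M k + (- ½) * S N (suc M) k ∎
    where
    open ≡-Reasoning
    h h′ : ℕ → ℚ
    h i = halfWeight N i * ℕ→ℚ ((M ℕ.+ i) C k)
    h′ i = halfWeight N i * ℕ→ℚ ((suc M ℕ.+ i) C k)
    term : ∀ i → halfWeight (suc N) (suc i) * ℕ→ℚ ((M ℕ.+ suc i) C k) ≡ (- ½) * h′ i + h (suc i)
    term i = begin
      (- ½) * (- ½) ^ℚ i * ℕ→ℚ (suc N C suc i) * ℕ→ℚ ((M ℕ.+ suc i) C k)
        ≡⟨ cong₂ (λ c m → (- ½) * (- ½) ^ℚ i * c * ℕ→ℚ (m C k)) (ℕ→ℚ-pascal N i) (+-suc M i) ⟩
      (- ½) * (- ½) ^ℚ i * (ℕ→ℚ (N C i) + ℕ→ℚ (N C suc i)) * ℕ→ℚ ((suc M ℕ.+ i) C k)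
        ≡⟨ solve 5 (λ m p a b y → m :* p :* (a :+ b) :* y := m :* (p :* a :* y) :+ m :* p :* b :* y) refl
             (- ½) ((- ½) ^ℚ i) (ℕ→ℚ (N C i)) (ℕ→ℚ (N C suc i)) (ℕ→ℚ ((suc M ℕ.+ i) C k)) ⟩
      (- ½) * h′ i + (- ½) * (- ½) ^ℚ i * ℕ→ℚ (N C suc i) * ℕ→ℚ ((suc M ℕ.+ i) C k)
        ≡⟨ cong (λ m → (- ½) * h′ i + (- ½) * (- ½) ^ℚ i * ℕ→ℚ (N C suc i) * ℕ→ℚ (m C k)) (sym (+-suc M i)) ⟩
      (- ½) * h′ i + h (suc i) ∎

  alternatingHalfSum-diagonal-1 : ∀ N → S (suc N) (suc N) 1 ≡ ½ * S N N 1
  alternatingHalfSum-diagonal-1 N = begin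
    S (suc N) (suc N) 1
      ≡⟨ alternatingHalfSum-suc N (suc N) 1 ⟩
    S N (suc N) 1 + (- ½) * S N (suc (suc N)) 1
      ≡⟨ cong₂ (λ x y → x + (- ½) * y) (alternatingHalfSum-pascal N N 0) (trans (alternatingHalfSum-pascal N (suc N) 0) (cong (_+ S N N 0) (alternatingHalfSum-pascal N N 0))) ⟩
    (S N N 1 + S N N 0) + (- ½) * ((S N N 1 + S N N 0) + S N N 0)
      ≡⟨ solve 2 (λ b₁ b₀ → (b₁ :+ b₀) :+ con (- ½) :* ((b₁ :+ b₀) :+ b₀) := con ½ :* b₁) refl (S N N 1) (S N N 0) ⟩
    ½ * S N N 1 ∎
    where open ≡-Reasoning

  alternatingHalfSum-diagonal-2+ : ∀ N k → S (suc N) (suc N) (suc (suc k)) ≡ ½ * (S N N (suc (suc k)) - S N N k)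
  alternatingHalfSum-diagonal-2+ N k = begin
    S (suc N) (suc N) (2 ℕ.+ k)
      ≡⟨ alternatingHalfSum-suc N (suc N) (2 ℕ.+ k) ⟩
    S N (suc N) (2 ℕ.+ k) + (- ½) * S N (suc (suc N)) (2 ℕ.+ k)
      ≡⟨ cong₂ (λ x y → x + (- ½) * y) (alternatingHalfSum-pascal N N (suc k))
           (trans (alternatingHalfSum-pascal N (suc N) (suc k)) (cong₂ _+_ (alternatingHalfSum-pascal N N (suc k)) (alternatingHalfSum-pascal N N k))) ⟩
    (S N N (2 ℕ.+ k) + S N N (suc k)) + (- ½) * ((S N N (2 ℕ.+ k) + S N N (suc k)) + (S N N (suc k) + S N N k))
      ≡⟨ solve 3 (λ b₂ b₁ b₀ → (b₂ :+ b₁) :+ con (- ½) :* ((b₂ :+ b₁) :+ (b₁ :+ b₀)) := con ½ :* (b₂ :- b₀))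
           refl (S N N (2 ℕ.+ k)) (S N N (suc k)) (S N N k) ⟩
    ½ * (S N N (2 ℕ.+ k) - S N N k) ∎
    where open ≡-Reasoning

  alternatingHalfSum-diagonal-odd : ∀ N k → ¬ 2 ∣ k → S N N k ≡ 0ℚ
  alternatingHalfSum-diagonal-odd N       zero          2∤k = ⊥-elim (2∤k (divides 0 refl))
  alternatingHalfSum-diagonal-odd zero    (suc k)       2∤k = refl
  alternatingHalfSum-diagonal-odd (suc N) (suc zero)    2∤k = trans (alternatingHalfSum-diagonal-1 N) (cong (½ *_) (alternatingHalfSum-diagonal-odd N 1 2∤k))
  alternatingHalfSum-diagonal-odd (suc N) (suc (suc k)) 2∤k = trans (alternatingHalfSum-diagonal-2+ N k)
    (trans (cong₂ (λ x y → ½ * (x - y)) (alternatingHalfSum-diagonal-odd N (2 ℕ.+ k) 2∤k) (alternatingHalfSum-diagonal-odd N k (λ 2∣k → 2∤k (∣m∣n⇒∣m+n ∣-refl 2∣k)))) refl)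

module WeightedEulerSums where
  open import Defs using (ℕ→ℚ; Σ<)
  open FiniteSums
  open NatToRational
  open Signs
  open BinomialTransform
  open EulerPolynomials
  open AlternatingHalfSums
  open import Data.Nat as ℕ using (ℕ; suc; _≤_; _∸_)
  open import Data.Nat.Properties using (+-monoʳ-≤; ≤-pred; +-identityʳ)
  open import Data.Nat.Divisibility using (_∣_; _∣?_; ∣m+n∣m⇒∣n)
  open import Relation.Nullary using (Dec; yes; no)
  open import Data.Nat.Combinatorics using (_C_)
  open import Data.Rational using (ℚ; _+_; _*_; -_; 0ℚ; 1ℚ)
  import Data.Rational.Properties as ℚₚ
  open import Data.Rational.Solver using (module +-*-Solver)
  open import Relation.Binary.PropositionalEquality using (_≡_; refl; cong; cong₂; trans; sym; module ≡-Reasoning)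
  open +-*-Solver

  halfWeighted-binomial-inversion : ∀ (a : ℕ → ℚ) N k →
    Σ< (suc N) (λ i → halfWeight N i * ℕ→ℚ ((N ℕ.+ i) C k) * (sign i * a (N ℕ.+ i ∸ k)))
      ≡ sign N * sign k * Σ< (suc (N ℕ.+ N)) (λ j → ℕ→ℚ ((k ℕ.+ j) C k) * alternate (binomial a) j * alternatingHalfSum N N (k ℕ.+ j))
  halfWeighted-binomial-inversion a N k = begin
    Σ< (suc N) (λ i → halfWeight N i * ℕ→ℚ ((N ℕ.+ i) C k) * (sign i * a (N ℕ.+ i ∸ k)))
      ≡⟨ Σ<-cong (suc N) (λ i i≤N → expand i (≤-pred i≤N)) ⟩
    Σ< (suc N) (λ i → Σ< (suc (N ℕ.+ N)) (λ j → sign N * sign k * term i j))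
      ≡⟨ Σ<-comm (suc N) (suc (N ℕ.+ N)) (λ i j → sign N * sign k * term i j) ⟩
    Σ< (suc (N ℕ.+ N)) (λ j → Σ< (suc N) (λ i → sign N * sign k * term i j))
      ≡⟨ Σ<-cong (suc (N ℕ.+ N)) (λ j _ → trans (sym (*-distribˡ-Σ< (suc N) (sign N * sign k) (λ i → term i j)))
                                              (cong (sign N * sign k *_) (sym (*-distribˡ-Σ< (suc N) (coefficient j) (λ i → halfWeight N i * ℕ→ℚ ((N ℕ.+ i) C (k ℕ.+ j))))))) ⟩
    Σ< (suc (N ℕ.+ N)) (λ j → sign N * sign k * (coefficient j * alternatingHalfSum N N (k ℕ.+ j)))
      ≡⟨ sym (*-distribˡ-Σ< (suc (N ℕ.+ N)) (sign N * sign k) (λ j → coefficient j * alternatingHalfSum N N (k ℕ.+ j))) ⟩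
    sign N * sign k * Σ< (suc (N ℕ.+ N)) (λ j → coefficient j * alternatingHalfSum N N (k ℕ.+ j)) ∎
    where
    open ≡-Reasoning
    coefficient : ℕ → ℚ
    coefficient j = ℕ→ℚ ((k ℕ.+ j) C k) * alternate (binomial a) j
    term : ℕ → ℕ → ℚ
    term i j = coefficient j * (halfWeight N i * ℕ→ℚ ((N ℕ.+ i) C (k ℕ.+ j)))
    expand : ∀ i → i ≤ N → halfWeight N i * ℕ→ℚ ((N ℕ.+ i) C k) * (sign i * a (N ℕ.+ i ∸ k))
                          ≡ Σ< (suc (N ℕ.+ N)) (λ j → sign N * sign k * term i j)
    expand i i≤N = begin
      halfWeight N i * ℕ→ℚ ((N ℕ.+ i) C k) * (sign i * a (N ℕ.+ i ∸ k))
        ≡⟨ solve 4 (λ w c s x → w :* c :* (s :* x) := (w :* s) :* (c :* x)) refl (halfWeight N i) (ℕ→ℚ ((N ℕ.+ i) C k)) (sign i) (a (N ℕ.+ i ∸ k)) ⟩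
      (halfWeight N i * sign i) * (ℕ→ℚ ((N ℕ.+ i) C k) * a (N ℕ.+ i ∸ k))
        ≡⟨ cong (halfWeight N i * sign i *_) (binomial-inversion-shifted a (N ℕ.+ i) k (N ℕ.+ N) (+-monoʳ-≤ N i≤N)) ⟩
      (halfWeight N i * sign i) * (sign (N ℕ.+ i) * sign k * Σ< (suc (N ℕ.+ N)) (binomialInversionTerm a (N ℕ.+ i) k))
        ≡⟨ solve 5 (λ w s t u x → (w :* s) :* (t :* u :* x) := (w :* s :* t :* u) :* x) refl
             (halfWeight N i) (sign i) (sign (N ℕ.+ i)) (sign k) (Σ< (suc (N ℕ.+ N)) (binomialInversionTerm a (N ℕ.+ i) k)) ⟩
      (halfWeight N i * sign i * sign (N ℕ.+ i) * sign k) * Σ< (suc (N ℕ.+ N)) (binomialInversionTerm a (N ℕ.+ i) k)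
        ≡⟨ *-distribˡ-Σ< (suc (N ℕ.+ N)) (halfWeight N i * sign i * sign (N ℕ.+ i) * sign k) (binomialInversionTerm a (N ℕ.+ i) k) ⟩
      Σ< (suc (N ℕ.+ N)) (λ j → halfWeight N i * sign i * sign (N ℕ.+ i) * sign k * binomialInversionTerm a (N ℕ.+ i) k j)
        ≡⟨ Σ<-cong (suc (N ℕ.+ N)) (λ j _ → regroup j) ⟩
      Σ< (suc (N ℕ.+ N)) (λ j → sign N * sign k * term i j) ∎
      where
      regroup : ∀ j → halfWeight N i * sign i * sign (N ℕ.+ i) * sign k * binomialInversionTerm a (N ℕ.+ i) k j ≡ sign N * sign k * term i j
      regroup j = begin
        halfWeight N i * sign i * sign (N ℕ.+ i) * sign k * (ℕ→ℚ ((k ℕ.+ j) C k) * ℕ→ℚ ((N ℕ.+ i) C (k ℕ.+ j)) * alternate (binomial a) j)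
          ≡⟨ solve 7 (λ w s t u c d g → w :* s :* t :* u :* (c :* d :* g) := (t :* s) :* (u :* (c :* g :* (w :* d)))) refl
               (halfWeight N i) (sign i) (sign (N ℕ.+ i)) (sign k) (ℕ→ℚ ((k ℕ.+ j) C k)) (ℕ→ℚ ((N ℕ.+ i) C (k ℕ.+ j))) (alternate (binomial a) j) ⟩
        (sign (N ℕ.+ i) * sign i) * (sign k * term i j)
          ≡⟨ cong (_* (sign k * term i j)) (sign-+-cancelʳ N i) ⟩
        sign N * (sign k * term i j)
          ≡⟨ solve 3 (λ s u t → s :* (u :* t) := s :* u :* t) refl (sign N) (sign k) (term i j) ⟩
        sign N * sign k * term i j ∎

  Euler-coefficient-sum : ∀ N k X → 2 ∣ k →
    Σ< (suc X) (λ j → ℕ→ℚ ((k ℕ.+ j) C k) * alternate (binomial E₀) j * alternatingHalfSum N N (k ℕ.+ j)) ≡ alternatingHalfSum N N k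
  Euler-coefficient-sum N k X 2∣k = trans (cong₂ _+_ head (Σ<-zero X _ (λ j _ → tail j (2 ∣? suc j)))) (ℚₚ.+-identityʳ (alternatingHalfSum N N k))
    where
    head : ℕ→ℚ ((k ℕ.+ 0) C k) * alternate (binomial E₀) 0 * alternatingHalfSum N N (k ℕ.+ 0) ≡ alternatingHalfSum N N k
    head = begin
      ℕ→ℚ ((k ℕ.+ 0) C k) * alternate (binomial E₀) 0 * alternatingHalfSum N N (k ℕ.+ 0)
        ≡⟨ cong (λ m → ℕ→ℚ (m C k) * alternate (binomial E₀) 0 * alternatingHalfSum N N m) (+-identityʳ k) ⟩
      ℕ→ℚ (k C k) * (1ℚ * 1ℚ) * alternatingHalfSum N N k
        ≡⟨ cong (λ c → c * (1ℚ * 1ℚ) * alternatingHalfSum N N k) (ℕ→ℚ-nCn≡1 k) ⟩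
      1ℚ * (1ℚ * 1ℚ) * alternatingHalfSum N N k
        ≡⟨ solve 1 (λ x → con 1ℚ :* (con 1ℚ :* con 1ℚ) :* x := x) refl (alternatingHalfSum N N k) ⟩
      alternatingHalfSum N N k ∎
      where open ≡-Reasoning
    tail : ∀ j → Dec (2 ∣ suc j) →
           ℕ→ℚ ((k ℕ.+ suc j) C k) * alternate (binomial E₀) (suc j) * alternatingHalfSum N N (k ℕ.+ suc j) ≡ 0ℚ
    tail j (yes 2∣1+j) = trans (cong (λ b → ℕ→ℚ ((k ℕ.+ suc j) C k) * (sign (suc j) * b) * alternatingHalfSum N N (k ℕ.+ suc j)) (binomial-E₀-even j 2∣1+j))
      (solve 3 (λ c s x → c :* (s :* con 0ℚ) :* x := con 0ℚ) refl (ℕ→ℚ ((k ℕ.+ suc j) C k)) (sign (suc j)) (alternatingHalfSum N N (k ℕ.+ suc j)))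
    tail j (no 2∤1+j) = trans (cong (ℕ→ℚ ((k ℕ.+ suc j) C k) * alternate (binomial E₀) (suc j) *_)
                                    (alternatingHalfSum-diagonal-odd N (k ℕ.+ suc j) (λ 2∣k+1+j → 2∤1+j (∣m+n∣m⇒∣n 2∣k+1+j 2∣k))))
      (ℚₚ.*-zeroʳ (ℕ→ℚ ((k ℕ.+ suc j) C k) * alternate (binomial E₀) (suc j)))

  halfWeighted-E₀-sum : ∀ N k → 2 ∣ k →
    Σ< (suc N) (λ i → halfWeight N i * ℕ→ℚ ((N ℕ.+ i) C k) * (sign i * E₀ (N ℕ.+ i ∸ k))) ≡ sign N * alternatingHalfSum N N k
  halfWeighted-E₀-sum N k 2∣k = begin
    Σ< (suc N) (λ i → halfWeight N i * ℕ→ℚ ((N ℕ.+ i) C k) * (sign i * E₀ (N ℕ.+ i ∸ k)))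
      ≡⟨ halfWeighted-binomial-inversion E₀ N k ⟩
    sign N * sign k * Σ< (suc (N ℕ.+ N)) (λ j → ℕ→ℚ ((k ℕ.+ j) C k) * alternate (binomial E₀) j * alternatingHalfSum N N (k ℕ.+ j))
      ≡⟨ cong₂ (λ s x → sign N * s * x) (sign-even 2∣k) (Euler-coefficient-sum N k (N ℕ.+ N) 2∣k) ⟩
    sign N * 1ℚ * alternatingHalfSum N N k
      ≡⟨ solve 2 (λ s x → s :* con 1ℚ :* x := s :* x) refl (sign N) (alternatingHalfSum N N k) ⟩
    sign N * alternatingHalfSum N N k ∎
    where open ≡-Reasoning

  halfWeighted-E₀-sum-vanishes : ∀ n k → 2 ∣ k →
    Σ< (suc (n ℕ.+ 1)) (λ i → halfWeight (n ℕ.+ 1) i * ℕ→ℚ ((n ℕ.+ 1 ℕ.+ i) C k) * (sign i * E₀ (n ℕ.+ 1 ℕ.+ i ∸ k) + sign n)) ≡ 0ℚ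
  halfWeighted-E₀-sum-vanishes n k 2∣k = begin
    Σ< (suc N) (λ i → halfWeight N i * c i * (sign i * E₀ (N ℕ.+ i ∸ k) + sign n))
      ≡⟨ Σ<-cong (suc N) (λ i _ → solve 4 (λ w c x s → w :* c :* (x :+ s) := w :* c :* x :+ s :* (w :* c)) refl
                                      (halfWeight N i) (c i) (sign i * E₀ (N ℕ.+ i ∸ k)) (sign n)) ⟩
    Σ< (suc N) (λ i → halfWeight N i * c i * (sign i * E₀ (N ℕ.+ i ∸ k)) + sign n * (halfWeight N i * c i))
      ≡⟨ Σ<-distrib-+ (suc N) (λ i → halfWeight N i * c i * (sign i * E₀ (N ℕ.+ i ∸ k))) (λ i → sign n * (halfWeight N i * c i)) ⟩
    Σ< (suc N) (λ i → halfWeight N i * c i * (sign i * E₀ (N ℕ.+ i ∸ k))) + Σ< (suc N) (λ i → sign n * (halfWeight N i * c i))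
      ≡⟨ cong₂ _+_ (halfWeighted-E₀-sum N k 2∣k) (sym (*-distribˡ-Σ< (suc N) (sign n) (λ i → halfWeight N i * c i))) ⟩
    sign N * alternatingHalfSum N N k + sign n * alternatingHalfSum N N k
      ≡⟨ cong (λ s → s * alternatingHalfSum N N k + sign n * alternatingHalfSum N N k) (sign-+ n 1) ⟩
    sign n * (- 1ℚ * 1ℚ) * alternatingHalfSum N N k + sign n * alternatingHalfSum N N k
      ≡⟨ solve 2 (λ s x → s :* (con (- 1ℚ) :* con 1ℚ) :* x :+ s :* x := con 0ℚ) refl (sign n) (alternatingHalfSum N N k) ⟩
    0ℚ ∎
    where
    open ≡-Reasoning
    N : ℕ
    N = n ℕ.+ 1
    c : ℕ → ℚ
    c i = ℕ→ℚ ((N ℕ.+ i) C k)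

open import Defs using (ℕ→ℚ; _^ℚ_; Σ<; E)
open import Data.Nat using (ℕ; _≤_; _+_; _∸_; suc)
open import Data.Nat.Properties using (+-assoc; +-comm)
open import Data.Nat.Combinatorics using (_C_)
open import Data.Nat.Divisibility using (_∣_)
open import Data.Product using (_×_; _,_)
open import Data.Rational using (_*_; -_; ½; 1ℚ; 0ℚ) renaming (_+_ to _+ℚ_)
open import Relation.Nullary using (¬_)
open import Relation.Binary.PropositionalEquality using (_≡_; cong; trans; sym)
open FiniteSums using (Σ<-cong)
open AlternatingHalfSums using (alternatingHalfSum-diagonal-odd)
open WeightedEulerSums using (halfWeighted-E₀-sum-vanishes)

corollary1p10 : (n k : ℕ) → 1 ≤ n →
    (2 ∣ k → Σ< (suc (n + 1)) (λ i → ((- ½) ^ℚ i) * ℕ→ℚ ((n + 1) C i) * ℕ→ℚ ((n + i + 1) C k) * (((- 1ℚ) ^ℚ i) * E (n + i + 1 ∸ k) 0ℚ +ℚ ((- 1ℚ) ^ℚ n))) ≡ 0ℚ)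
    × (¬ (2 ∣ k) → Σ< (suc (n + 1)) (λ i → ((- ½) ^ℚ i) * ℕ→ℚ ((n + 1) C i) * ℕ→ℚ ((n + i + 1) C k)) ≡ 0ℚ)
corollary1p10 n k _ =
    (λ 2∣k → trans (Σ<-cong (suc (n + 1)) (λ i _ → cong (λ m → ((- ½) ^ℚ i) * ℕ→ℚ ((n + 1) C i) * ℕ→ℚ (m C k) * (((- 1ℚ) ^ℚ i) * E (m ∸ k) 0ℚ +ℚ ((- 1ℚ) ^ℚ n))) (reindex i)))
                   (halfWeighted-E₀-sum-vanishes n k 2∣k))
  , (λ 2∤k → trans (Σ<-cong (suc (n + 1)) (λ i _ → cong (λ m → ((- ½) ^ℚ i) * ℕ→ℚ ((n + 1) C i) * ℕ→ℚ (m C k)) (reindex i)))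
                   (alternatingHalfSum-diagonal-odd (n + 1) k 2∤k))
  where
  reindex : ∀ i → n + i + 1 ≡ n + 1 + i
  reindex i = trans (+-assoc n i 1) (trans (cong (n +_) (+-comm i 1)) (sym (+-assoc n 1 i)))
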